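{- Let $\mathbb{C}$ be a ribbon category and $A$ a reflexive object with isomorphism $\varphi:A\otimes A^*\to A$. Then (i) ($\beta$-equality) $(\mathbf{lam}\otimes A);(A\otimes\sigma_{A,A}^{ -1});(\mathbf{app}\otimes A)=A\otimes\theta_A^{ -1}:A\otimes A\to A\otimes A$, and (ii) ($\eta$-equality) $\mathrm{Tr}^A_{A,A}(\mathbf{app};\mathbf{lam})=\mathrm{id}_A:A\to A$.
   Context: Ribbon category: a (strict) braided monoidal category with braid $\sigma_{X,Y}:X\otimes Y\to Y\otimes X$, natural twist isomorphism $\theta$ with $\theta_{X\otimes Y}=\sigma_{X,Y};(\theta_Y\otimes\theta_X);\sigma_{Y,X}$, every object $X$ having a chosen left dual $X^*$ with unit $\eta_X:I\to X\otimes X^*$, counit $\varepsilon_X:X^*\otimes X\to I$ satisfying the snake equations, and $(\theta_X)^*=\theta_{X^*}$; composition $f;g$ is diagrammatic ($f$ first). Trace: $\mathrm{Tr}^X_{U,V}(f)=(U\otimes\eta_X);(f\otimes X^*);(V\otimes(\sigma_{X,X^*};(X^*\otimes\theta_X);\varepsilon_X))$ for $f:U\otimes X\to V\otimes X$. A reflexive object is an object $A$ with an isomorphism $\varphi:A\otimes A^*\to A$. $\mathbf{app}:=(\varphi^{ -1}\otimes A);(A\otimes\varepsilon_A):A\otimes A\to A$; $\mathbf{lam}:=(A\otimes\eta_A);(A\otimes A\otimes\theta_{A^*}^{ -1});(A\otimes\sigma^{ -1}_{A^*,A});(\varphi\otimes A):A\to A\otimes A$. -}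

module Defs where

open import Level using (Level; _⊔_; suc)
open import Relation.Binary using (IsEquivalence)

-- A ribbon category, presented non-strictly (explicit associator and unitors
-- with pentagon/triangle coherence).  By Mac Lane's coherence theorem this is
-- equivalent to the strict presentation used in the paper.
-- Composition f ⨾ g is diagrammatic (f first).
record RibbonCategory (o ℓ e : Level) : Set (suc (o ⊔ ℓ ⊔ e)) where
  infix  4 _≈_
  infixr 9 _⨾_
  infixr 10 _⊗₀_ _⊗₁_
  field
    Obj  : Set o
    _⇒_  : Obj → Obj → Set ℓ
    _≈_  : ∀ {X Y} → X ⇒ Y → X ⇒ Y → Set e
    ≈-equiv : ∀ {X Y} → IsEquivalence (_≈_ {X} {Y})
    id   : ∀ {X} → X ⇒ X
    _⨾_  : ∀ {X Y Z} → X ⇒ Y → Y ⇒ Z → X ⇒ Z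
    ⨾-assoc : ∀ {W X Y Z} {f : W ⇒ X} {g : X ⇒ Y} {h : Y ⇒ Z} →
              (f ⨾ g) ⨾ h ≈ f ⨾ (g ⨾ h)
    identityˡ : ∀ {X Y} {f : X ⇒ Y} → id ⨾ f ≈ f
    identityʳ : ∀ {X Y} {f : X ⇒ Y} → f ⨾ id ≈ f
    ⨾-resp-≈ : ∀ {X Y Z} {f f′ : X ⇒ Y} {g g′ : Y ⇒ Z} →
               f ≈ f′ → g ≈ g′ → f ⨾ g ≈ f′ ⨾ g′
    I     : Obj
    _⊗₀_  : Obj → Obj → Obj
    _⊗₁_  : ∀ {X Y Z W} → X ⇒ Y → Z ⇒ W → (X ⊗₀ Z) ⇒ (Y ⊗₀ W)
    ⊗-id  : ∀ {X Y} → id {X} ⊗₁ id {Y} ≈ id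
    ⊗-⨾   : ∀ {X₁ X₂ X₃ Y₁ Y₂ Y₃} {f : X₁ ⇒ X₂} {g : X₂ ⇒ X₃}
              {h : Y₁ ⇒ Y₂} {k : Y₂ ⇒ Y₃} →
            (f ⨾ g) ⊗₁ (h ⨾ k) ≈ (f ⊗₁ h) ⨾ (g ⊗₁ k)
    ⊗-resp-≈ : ∀ {X Y Z W} {f f′ : X ⇒ Y} {g g′ : Z ⇒ W} →
               f ≈ f′ → g ≈ g′ → f ⊗₁ g ≈ f′ ⊗₁ g′
    α  : ∀ {X Y Z} → ((X ⊗₀ Y) ⊗₀ Z) ⇒ (X ⊗₀ (Y ⊗₀ Z))
    α⁻ : ∀ {X Y Z} → (X ⊗₀ (Y ⊗₀ Z)) ⇒ ((X ⊗₀ Y) ⊗₀ Z)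
    α-iso₁ : ∀ {X Y Z} → α {X} {Y} {Z} ⨾ α⁻ ≈ id
    α-iso₂ : ∀ {X Y Z} → α⁻ {X} {Y} {Z} ⨾ α ≈ id
    α-natural : ∀ {X X′ Y Y′ Z Z′} {f : X ⇒ X′} {g : Y ⇒ Y′} {h : Z ⇒ Z′} →
                ((f ⊗₁ g) ⊗₁ h) ⨾ α ≈ α ⨾ (f ⊗₁ (g ⊗₁ h))
    λ⇒ : ∀ {X} → (I ⊗₀ X) ⇒ X
    λ⇐ : ∀ {X} → X ⇒ (I ⊗₀ X)
    λ-iso₁ : ∀ {X} → λ⇒ {X} ⨾ λ⇐ ≈ id
    λ-iso₂ : ∀ {X} → λ⇐ {X} ⨾ λ⇒ ≈ id
    λ-natural : ∀ {X Y} {f : X ⇒ Y} → (id {I} ⊗₁ f) ⨾ λ⇒ ≈ λ⇒ ⨾ f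
    ρ⇒ : ∀ {X} → (X ⊗₀ I) ⇒ X
    ρ⇐ : ∀ {X} → X ⇒ (X ⊗₀ I)
    ρ-iso₁ : ∀ {X} → ρ⇒ {X} ⨾ ρ⇐ ≈ id
    ρ-iso₂ : ∀ {X} → ρ⇐ {X} ⨾ ρ⇒ ≈ id
    ρ-natural : ∀ {X Y} {f : X ⇒ Y} → (f ⊗₁ id {I}) ⨾ ρ⇒ ≈ ρ⇒ ⨾ f
    pentagon : ∀ {W X Y Z} →
      (α {W} {X} {Y} ⊗₁ id {Z}) ⨾ α {W} {X ⊗₀ Y} {Z} ⨾ (id {W} ⊗₁ α {X} {Y} {Z})
        ≈ α {W ⊗₀ X} {Y} {Z} ⨾ α {W} {X} {Y ⊗₀ Z}
    triangle : ∀ {X Y} → α {X} {I} {Y} ⨾ (id {X} ⊗₁ λ⇒ {Y}) ≈ ρ⇒ {X} ⊗₁ id {Y}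
    σ  : ∀ {X Y} → (X ⊗₀ Y) ⇒ (Y ⊗₀ X)
    σ⁻ : ∀ {X Y} → (Y ⊗₀ X) ⇒ (X ⊗₀ Y)
    σ-iso₁ : ∀ {X Y} → σ {X} {Y} ⨾ σ⁻ {X} {Y} ≈ id
    σ-iso₂ : ∀ {X Y} → σ⁻ {X} {Y} ⨾ σ {X} {Y} ≈ id
    σ-natural : ∀ {X X′ Y Y′} {f : X ⇒ X′} {g : Y ⇒ Y′} →
                (f ⊗₁ g) ⨾ σ ≈ σ ⨾ (g ⊗₁ f)
    hexagon₁ : ∀ {X Y Z} →
      α {X} {Y} {Z} ⨾ σ {X} {Y ⊗₀ Z} ⨾ α {Y} {Z} {X}
        ≈ (σ {X} {Y} ⊗₁ id {Z}) ⨾ α {Y} {X} {Z} ⨾ (id {Y} ⊗₁ σ {X} {Z})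
    hexagon₂ : ∀ {X Y Z} →
      α⁻ {X} {Y} {Z} ⨾ σ {X ⊗₀ Y} {Z} ⨾ α⁻ {Z} {X} {Y}
        ≈ (id {X} ⊗₁ σ {Y} {Z}) ⨾ α⁻ {X} {Z} {Y} ⨾ (σ {X} {Z} ⊗₁ id {Y})
    θ  : ∀ {X} → X ⇒ X
    θ⁻ : ∀ {X} → X ⇒ X
    θ-iso₁ : ∀ {X} → θ {X} ⨾ θ⁻ {X} ≈ id
    θ-iso₂ : ∀ {X} → θ⁻ {X} ⨾ θ {X} ≈ id
    θ-natural : ∀ {X Y} {f : X ⇒ Y} → f ⨾ θ ≈ θ ⨾ f
    balance : ∀ {X Y} →
      θ {X ⊗₀ Y} ≈ σ {X} {Y} ⨾ (θ {Y} ⊗₁ θ {X}) ⨾ σ {Y} {X}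
    _* : Obj → Obj
    η  : ∀ X → I ⇒ (X ⊗₀ (X *))
    ε  : ∀ X → ((X *) ⊗₀ X) ⇒ I
    snake₁ : ∀ {X} →
      λ⇐ ⨾ (η X ⊗₁ id) ⨾ α ⨾ (id ⊗₁ ε X) ⨾ ρ⇒ ≈ id {X}
    snake₂ : ∀ {X} →
      ρ⇐ ⨾ (id ⊗₁ η X) ⨾ α⁻ ⨾ (ε X ⊗₁ id) ⨾ λ⇒ ≈ id {X *}

  dual : ∀ {X Y} → X ⇒ Y → (Y *) ⇒ (X *)
  dual {X} {Y} f =
    ρ⇐ ⨾ (id ⊗₁ η X) ⨾ α⁻ ⨾ ((id ⊗₁ f) ⊗₁ id) ⨾ (ε Y ⊗₁ id) ⨾ λ⇒

  field
    θ-dual : ∀ {X} → dual (θ {X}) ≈ θ {X *}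

record ReflexiveObject {o ℓ e} (C : RibbonCategory o ℓ e) : Set (o ⊔ ℓ ⊔ e) where
  open RibbonCategory C
  field
    A  : Obj
    φ  : (A ⊗₀ (A *)) ⇒ A
    φ⁻ : A ⇒ (A ⊗₀ (A *))
    φ-iso₁ : φ ⨾ φ⁻ ≈ id
    φ-iso₂ : φ⁻ ⨾ φ ≈ id

module _ {o ℓ e} (C : RibbonCategory o ℓ e) where
  open RibbonCategory C

  Tr : ∀ {U V X} → (U ⊗₀ X) ⇒ (V ⊗₀ X) → U ⇒ V
  Tr {U} {V} {X} f =
    ρ⇐ ⨾ (id {U} ⊗₁ η X) ⨾ α⁻ ⨾ (f ⊗₁ id {X *}) ⨾ α
      ⨾ (id {V} ⊗₁ (σ {X} {X *} ⨾ (id {X *} ⊗₁ θ {X}) ⨾ ε X)) ⨾ ρ⇒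

  module _ (R : ReflexiveObject C) where
    open ReflexiveObject R

    app : (A ⊗₀ A) ⇒ A
    app = (φ⁻ ⊗₁ id {A}) ⨾ α ⨾ (id {A} ⊗₁ ε A) ⨾ ρ⇒

    lam : A ⇒ (A ⊗₀ A)
    lam = ρ⇐ ⨾ (id {A} ⊗₁ η A) ⨾ (id {A} ⊗₁ (id {A} ⊗₁ θ⁻ {A *}))
            ⨾ (id {A} ⊗₁ σ⁻ {A *} {A}) ⨾ α⁻ ⨾ (φ ⊗₁ id {A})

{-# OPTIONS --safe #-}
module Submission where

-- Write lam = cupʳ coevʳ ⨾ (φ ⊗ A) and app = (φ⁻¹ ⊗ A) ⨾ capʳ ε, where coevʳ and the cap
-- evʳ of Tr make A* a right dual of A as well.  In (i) φ and φ⁻¹ meet and cancel, leaving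
-- A ⊗ κ for the curl κ built from coevʳ, a negative crossing and ε.  The hexagon axioms
-- merge the two crossings of κ into a braiding with the unit object, which is trivial; what
-- remains is the zig-zag identity with θ⁻¹ on the A*-strand, and the ribbon condition
-- (θ_A)* = θ_{A*} slides it onto A, so κ = θ⁻¹.  In (ii) naturality and superposing of the
-- trace turn Tr(app ⨾ lam) into φ⁻¹ ⨾ (A ⊗ Tr(ε ⨾ coevʳ)) ⨾ φ, and Tr(ε ⨾ coevʳ) is the
-- zig-zag of the left duality followed by that of the right one, hence the identity.

open import Data.Product using (_×_; _,_)
open import Relation.Binary using (Setoid; IsEquivalence)
import Relation.Binary.Reasoning.Setoid as SetoidReasoning

open import Defs

module RibbonProperties {o ℓ e} (C : RibbonCategory o ℓ e) where
  open RibbonCategory C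

  private variable
    U V W X Y Z X′ Y′ : Obj
    c d f f′ f₁ f₂ f₃ f₁′ f₂′ f₃′ g g′ g₁ g₂ g₃ g₁′ g₂′ g₃′ h h′ k m : X ⇒ Y

  hom-setoid : Obj → Obj → Setoid ℓ e
  hom-setoid X Y = record { Carrier = X ⇒ Y ; _≈_ = _≈_ ; isEquivalence = ≈-equiv }

  module HomReasoning {X Y : Obj} = SetoidReasoning (hom-setoid X Y)
  open HomReasoning
  module Equiv {X Y : Obj} = IsEquivalence (≈-equiv {X} {Y})
  open Equiv using (refl; sym; trans)

  infixr 5 _⟩⨾⟨_ refl⟩⨾⟨_
  infixl 6 _⟩⨾⟨refl
  infix  6 _⟩⊗⟨_

  _⟩⨾⟨_ : f ≈ f′ → g ≈ g′ → f ⨾ g ≈ f′ ⨾ g′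
  _⟩⨾⟨_ = ⨾-resp-≈

  refl⟩⨾⟨_ : g ≈ g′ → f ⨾ g ≈ f ⨾ g′
  refl⟩⨾⟨ p = refl ⟩⨾⟨ p

  _⟩⨾⟨refl : f ≈ f′ → f ⨾ g ≈ f′ ⨾ g
  p ⟩⨾⟨refl = p ⟩⨾⟨ refl

  _⟩⊗⟨_ : f ≈ f′ → g ≈ g′ → f ⊗₁ g ≈ f′ ⊗₁ g′
  _⟩⊗⟨_ = ⊗-resp-≈

  assoc₃ : (f₁ ⨾ f₂ ⨾ f₃) ⨾ k ≈ f₁ ⨾ f₂ ⨾ f₃ ⨾ k
  assoc₃ = trans ⨾-assoc (refl⟩⨾⟨ ⨾-assoc)

  -- prefixₘₙ rewrites the first m factors of a right-nested composite into n factors.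
  prefix₁₂ : f ≈ g₁ ⨾ g₂ → f ⨾ k ≈ g₁ ⨾ g₂ ⨾ k
  prefix₁₂ p = trans (p ⟩⨾⟨refl) ⨾-assoc

  prefix₂₁ : f₁ ⨾ f₂ ≈ g → f₁ ⨾ f₂ ⨾ k ≈ g ⨾ k
  prefix₂₁ p = trans (sym ⨾-assoc) (p ⟩⨾⟨refl)

  prefix₂₂ : f₁ ⨾ f₂ ≈ g₁ ⨾ g₂ → f₁ ⨾ f₂ ⨾ k ≈ g₁ ⨾ g₂ ⨾ k
  prefix₂₂ p = trans (prefix₂₁ p) ⨾-assoc

  prefix₁₃ : f ≈ g₁ ⨾ g₂ ⨾ g₃ → f ⨾ k ≈ g₁ ⨾ g₂ ⨾ g₃ ⨾ k
  prefix₁₃ p = trans (p ⟩⨾⟨refl) assoc₃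

  prefix₃₁ : f₁ ⨾ f₂ ⨾ f₃ ≈ g → f₁ ⨾ f₂ ⨾ f₃ ⨾ k ≈ g ⨾ k
  prefix₃₁ p = trans (sym assoc₃) (p ⟩⨾⟨refl)

  prefix₂₃ : f₁ ⨾ f₂ ≈ g₁ ⨾ g₂ ⨾ g₃ → f₁ ⨾ f₂ ⨾ k ≈ g₁ ⨾ g₂ ⨾ g₃ ⨾ k
  prefix₂₃ p = trans (prefix₂₁ p) assoc₃

  prefix₃₂ : f₁ ⨾ f₂ ⨾ f₃ ≈ g₁ ⨾ g₂ → f₁ ⨾ f₂ ⨾ f₃ ⨾ k ≈ g₁ ⨾ g₂ ⨾ k
  prefix₃₂ p = trans (prefix₃₁ p) ⨾-assoc

  prefix₃₃ : f₁ ⨾ f₂ ⨾ f₃ ≈ g₁ ⨾ g₂ ⨾ g₃ → f₁ ⨾ f₂ ⨾ f₃ ⨾ k ≈ g₁ ⨾ g₂ ⨾ g₃ ⨾ k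
  prefix₃₃ p = trans (prefix₃₁ p) assoc₃

  cancelˡ : f ⨾ g ≈ id → f ⨾ g ⨾ h ≈ h
  cancelˡ p = trans (prefix₂₁ p) identityˡ

  cancelʳ : f ⨾ g ≈ id → h ⨾ f ⨾ g ≈ h
  cancelʳ p = trans (refl⟩⨾⟨ p) identityʳ

  monic : g ⨾ f ≈ id → f ⨾ h ≈ f ⨾ h′ → h ≈ h′
  monic {g = g} {f = f} {h = h} {h′ = h′} gf p = begin
    h          ≈⟨ cancelˡ gf ⟨
    g ⨾ f ⨾ h  ≈⟨ refl⟩⨾⟨ p ⟩
    g ⨾ f ⨾ h′ ≈⟨ cancelˡ gf ⟩
    h′         ∎

  epic : f ⨾ g ≈ id → h ⨾ f ≈ h′ ⨾ f → h ≈ h′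
  epic {f = f} {g = g} {h = h} {h′ = h′} fg p = begin
    h            ≈⟨ cancelʳ fg ⟨
    h ⨾ f ⨾ g    ≈⟨ prefix₂₁ p ⟩
    (h′ ⨾ f) ⨾ g ≈⟨ ⨾-assoc ⟩
    h′ ⨾ f ⨾ g   ≈⟨ cancelʳ fg ⟩
    h′           ∎

  inverse-unique : g ⨾ f ≈ id → f ⨾ h ≈ id → g ≈ h
  inverse-unique {g = g} {f = f} {h = h} gf fh = begin
    g         ≈⟨ cancelʳ fh ⟨
    g ⨾ f ⨾ h ≈⟨ cancelˡ gf ⟩
    h         ∎

  ⨾-inverse : f ⨾ f′ ≈ id → g ⨾ g′ ≈ id → (f ⨾ g) ⨾ (g′ ⨾ f′) ≈ id
  ⨾-inverse ff′ gg′ = trans ⨾-assoc (trans (refl⟩⨾⟨ cancelˡ gg′) ff′)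

  inverse-of-⨾ : f₁ ⨾ f₂ ≈ g → g′ ⨾ g ≈ id → f₂ ⨾ f₂′ ≈ id → f₁ ⨾ f₁′ ≈ id →
                 f₂′ ⨾ f₁′ ≈ g′
  inverse-of-⨾ split g′g f₂f₂′ f₁f₁′ =
    sym (inverse-unique g′g (trans (sym split ⟩⨾⟨refl) (⨾-inverse f₁f₁′ f₂f₂′)))

  inverse-of-⨾₃ : f₁ ⨾ f₂ ⨾ f₃ ≈ g₁ ⨾ g₂ ⨾ g₃ →
                  f₁′ ⨾ f₁ ≈ id → f₂′ ⨾ f₂ ≈ id → f₃′ ⨾ f₃ ≈ id →
                  g₁ ⨾ g₁′ ≈ id → g₂ ⨾ g₂′ ≈ id → g₃ ⨾ g₃′ ≈ id →
                  f₃′ ⨾ f₂′ ⨾ f₁′ ≈ g₃′ ⨾ g₂′ ⨾ g₁′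
  inverse-of-⨾₃ eq p₁ p₂ p₃ q₁ q₂ q₃ = inverse-unique
    (trans (refl⟩⨾⟨ trans (sym eq) (sym ⨾-assoc)) (⨾-inverse p₃ (⨾-inverse p₂ p₁)))
    (trans (refl⟩⨾⟨ sym ⨾-assoc) (⨾-inverse q₁ (⨾-inverse q₂ q₃)))

  conjugate : {i : X ⇒ Y} {j : Y ⇒ X} {i′ : X′ ⇒ Y′} {j′ : Y′ ⇒ X′} {a : X ⇒ X′} {b : Y ⇒ Y′} →
              j ⨾ i ≈ id → i′ ⨾ j′ ≈ id → a ⨾ i′ ≈ i ⨾ b → j ⨾ a ≈ b ⨾ j′
  conjugate {i = i} {j} {i′} {j′} {a} {b} ji i′j′ square = begin
    j ⨾ a           ≈⟨ refl⟩⨾⟨ cancelʳ i′j′ ⟨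
    j ⨾ a ⨾ i′ ⨾ j′ ≈⟨ refl⟩⨾⟨ prefix₂₂ square ⟩
    j ⨾ i ⨾ b ⨾ j′  ≈⟨ cancelˡ ji ⟩
    b ⨾ j′          ∎

  -- Tensor products

  id⊗-distrib : id {W} ⊗₁ h ≈ h′ → id ⊗₁ (g ⨾ h) ≈ (id ⊗₁ g) ⨾ h′
  id⊗-distrib p = trans (trans (sym identityˡ ⟩⊗⟨ refl) ⊗-⨾) (refl⟩⨾⟨ p)

  ⊗id-distrib : h ⊗₁ id {W} ≈ h′ → (g ⨾ h) ⊗₁ id ≈ (g ⊗₁ id) ⨾ h′
  ⊗id-distrib p = trans (trans (refl ⟩⊗⟨ sym identityˡ) ⊗-⨾) (refl⟩⨾⟨ p)

  id⊗-inverse : f ⨾ g ≈ id → (id {W} ⊗₁ f) ⨾ (id ⊗₁ g) ≈ id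
  id⊗-inverse p = trans (sym (id⊗-distrib refl)) (trans (refl ⟩⊗⟨ p) ⊗-id)

  ⊗id-inverse : f ⨾ g ≈ id → (f ⊗₁ id {W}) ⨾ (g ⊗₁ id) ≈ id
  ⊗id-inverse p = trans (sym (⊗id-distrib refl)) (trans (p ⟩⊗⟨ refl) ⊗-id)

  interchange : (f ⊗₁ id) ⨾ (id ⊗₁ g) ≈ (id ⊗₁ g) ⨾ (f ⊗₁ id)
  interchange = trans (sym ⊗-⨾) (trans (swap ⟩⊗⟨ sym swap) ⊗-⨾)
    where
    swap : f ⨾ id ≈ id ⨾ f
    swap = trans identityʳ (sym identityˡ)

  α⁻-natural : (f ⊗₁ (g ⊗₁ h)) ⨾ α⁻ ≈ α⁻ ⨾ ((f ⊗₁ g) ⊗₁ h)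
  α⁻-natural = sym (conjugate α-iso₂ α-iso₁ α-natural)

  λ⇐-natural : f ⨾ λ⇐ ≈ λ⇐ ⨾ (id ⊗₁ f)
  λ⇐-natural = sym (conjugate λ-iso₂ λ-iso₁ λ-natural)

  ρ⇐-natural : f ⨾ ρ⇐ ≈ ρ⇐ ⨾ (f ⊗₁ id)
  ρ⇐-natural = sym (conjugate ρ-iso₂ ρ-iso₁ ρ-natural)

  σ⁻-natural : (g ⊗₁ f) ⨾ σ⁻ ≈ σ⁻ ⨾ (f ⊗₁ g)
  σ⁻-natural = sym (conjugate σ-iso₂ σ-iso₁ σ-natural)

  α-natural-⊗id : ((f ⊗₁ id {Y}) ⊗₁ id {Z}) ⨾ α ≈ α ⨾ (f ⊗₁ id)
  α-natural-⊗id = trans α-natural (refl⟩⨾⟨ (refl ⟩⊗⟨ ⊗-id))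

  α⁻-natural-⊗id : (f ⊗₁ id {Y ⊗₀ Z}) ⨾ α⁻ ≈ α⁻ ⨾ ((f ⊗₁ id) ⊗₁ id)
  α⁻-natural-⊗id = trans ((refl ⟩⊗⟨ sym ⊗-id) ⟩⨾⟨refl) α⁻-natural

  α-natural-id⊗ : α {X} {Y} ⨾ (id ⊗₁ (id ⊗₁ f)) ≈ (id ⊗₁ f) ⨾ α
  α-natural-id⊗ = trans (sym α-natural) ((⊗-id ⟩⊗⟨ refl) ⟩⨾⟨refl)

  α⁻-natural-id⊗ : α⁻ ⨾ (id {X ⊗₀ Y} ⊗₁ f) ≈ (id ⊗₁ (id ⊗₁ f)) ⨾ α⁻
  α⁻-natural-id⊗ = trans (refl⟩⨾⟨ (sym ⊗-id ⟩⊗⟨ refl)) (sym α⁻-natural)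

  cancel-around-id⊗ : f ⨾ f′ ≈ id →
    ((f ⊗₁ id) ⊗₁ id) ⨾ α ⨾ (id ⊗₁ g) ⨾ α⁻ ⨾ ((f′ ⊗₁ id) ⊗₁ id) ⨾ k ≈ α ⨾ (id ⊗₁ g) ⨾ α⁻ ⨾ k
  cancel-around-id⊗ {f = f} {f′ = f′} {g = g} {k = k} ff′ = begin
    ((f ⊗₁ id) ⊗₁ id) ⨾ α ⨾ (id ⊗₁ g) ⨾ α⁻ ⨾ ((f′ ⊗₁ id) ⊗₁ id) ⨾ k  ≈⟨ prefix₂₂ α-natural-⊗id ⟩
    α ⨾ (f ⊗₁ id) ⨾ (id ⊗₁ g) ⨾ α⁻ ⨾ ((f′ ⊗₁ id) ⊗₁ id) ⨾ k          ≈⟨ refl⟩⨾⟨ prefix₂₂ interchange ⟩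
    α ⨾ (id ⊗₁ g) ⨾ (f ⊗₁ id) ⨾ α⁻ ⨾ ((f′ ⊗₁ id) ⊗₁ id) ⨾ k          ≈⟨ refl⟩⨾⟨ refl⟩⨾⟨ prefix₂₂ α⁻-natural-⊗id ⟩
    α ⨾ (id ⊗₁ g) ⨾ α⁻ ⨾ ((f ⊗₁ id) ⊗₁ id) ⨾ ((f′ ⊗₁ id) ⊗₁ id) ⨾ k
      ≈⟨ refl⟩⨾⟨ refl⟩⨾⟨ refl⟩⨾⟨ cancelˡ (⊗id-inverse (⊗id-inverse ff′)) ⟩
    α ⨾ (id ⊗₁ g) ⨾ α⁻ ⨾ k                                          ∎

  -- Coherence

  triangle-ρ⇐ : (ρ⇐ {X} ⊗₁ id {Y}) ⨾ α ≈ id ⊗₁ λ⇐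
  triangle-ρ⇐ = begin
    (ρ⇐ ⊗₁ id) ⨾ α                           ≈⟨ refl⟩⨾⟨ cancelʳ (id⊗-inverse λ-iso₁) ⟨
    (ρ⇐ ⊗₁ id) ⨾ α ⨾ (id ⊗₁ λ⇒) ⨾ (id ⊗₁ λ⇐) ≈⟨ refl⟩⨾⟨ prefix₂₁ triangle ⟩
    (ρ⇐ ⊗₁ id) ⨾ (ρ⇒ ⊗₁ id) ⨾ (id ⊗₁ λ⇐)     ≈⟨ cancelˡ (⊗id-inverse ρ-iso₂) ⟩
    id ⊗₁ λ⇐                                 ∎

  triangle-α⁻ : α⁻ ⨾ (ρ⇒ {X} ⊗₁ id {Y}) ≈ id ⊗₁ λ⇒
  triangle-α⁻ = trans (refl⟩⨾⟨ sym triangle) (cancelˡ α-iso₂)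

  pentagon-α⁻⊗id : (α⁻ {W} {X} {Y} ⊗₁ id {Z}) ⨾ α ≈ α ⨾ (id ⊗₁ α) ⨾ α⁻
  pentagon-α⁻⊗id = begin
    (α⁻ ⊗₁ id) ⨾ α                                   ≈⟨ refl⟩⨾⟨ cancelʳ α-iso₁ ⟨
    (α⁻ ⊗₁ id) ⨾ α ⨾ α ⨾ α⁻                          ≈⟨ refl⟩⨾⟨ prefix₃₂ pentagon ⟨
    (α⁻ ⊗₁ id) ⨾ (α ⊗₁ id) ⨾ α ⨾ (id ⊗₁ α) ⨾ α⁻      ≈⟨ cancelˡ (⊗id-inverse α-iso₂) ⟩
    α ⨾ (id ⊗₁ α) ⨾ α⁻                               ∎

  pentagon-α⊗id : α⁻ {W ⊗₀ X} {Y} {Z} ⨾ (α ⊗₁ id) ≈ α ⨾ (id ⊗₁ α⁻) ⨾ α⁻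
  pentagon-α⊗id = begin
    α⁻ ⨾ (α ⊗₁ id)
      ≈⟨ refl⟩⨾⟨ cancelʳ (trans (refl⟩⨾⟨ cancelˡ (id⊗-inverse α-iso₁)) α-iso₁) ⟨
    α⁻ ⨾ (α ⊗₁ id) ⨾ α ⨾ (id ⊗₁ α) ⨾ (id ⊗₁ α⁻) ⨾ α⁻
      ≈⟨ refl⟩⨾⟨ prefix₃₂ pentagon ⟩
    α⁻ ⨾ α ⨾ α ⨾ (id ⊗₁ α⁻) ⨾ α⁻
      ≈⟨ cancelˡ α-iso₂ ⟩
    α ⨾ (id ⊗₁ α⁻) ⨾ α⁻
      ∎

  I⊗-faithful : id {I} ⊗₁ f ≈ id ⊗₁ g → f ≈ g
  I⊗-faithful {f = f} {g = g} p = begin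
    f                  ≈⟨ cancelˡ λ-iso₂ ⟨
    λ⇐ ⨾ λ⇒ ⨾ f        ≈⟨ refl⟩⨾⟨ λ-natural ⟨
    λ⇐ ⨾ (id ⊗₁ f) ⨾ λ⇒ ≈⟨ refl⟩⨾⟨ p ⟩⨾⟨refl ⟩
    λ⇐ ⨾ (id ⊗₁ g) ⨾ λ⇒ ≈⟨ refl⟩⨾⟨ λ-natural ⟩
    λ⇐ ⨾ λ⇒ ⨾ g        ≈⟨ cancelˡ λ-iso₂ ⟩
    g                  ∎

  ⊗I-faithful : f ⊗₁ id {I} ≈ g ⊗₁ id → f ≈ g
  ⊗I-faithful {f = f} {g = g} p = begin
    f                  ≈⟨ cancelˡ ρ-iso₂ ⟨
    ρ⇐ ⨾ ρ⇒ ⨾ f        ≈⟨ refl⟩⨾⟨ ρ-natural ⟨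
    ρ⇐ ⨾ (f ⊗₁ id) ⨾ ρ⇒ ≈⟨ refl⟩⨾⟨ p ⟩⨾⟨refl ⟩
    ρ⇐ ⨾ (g ⊗₁ id) ⨾ ρ⇒ ≈⟨ refl⟩⨾⟨ ρ-natural ⟩
    ρ⇐ ⨾ ρ⇒ ⨾ g        ≈⟨ cancelˡ ρ-iso₂ ⟩
    g                  ∎

  kelly₁ : α {I} {X} {Y} ⨾ λ⇒ ≈ λ⇒ ⊗₁ id
  kelly₁ = I⊗-faithful (monic α-iso₂ (monic (⊗id-inverse α-iso₂) (begin
    (α ⊗₁ id) ⨾ α ⨾ (id ⊗₁ (α ⨾ λ⇒))        ≈⟨ refl⟩⨾⟨ refl⟩⨾⟨ id⊗-distrib refl ⟩
    (α ⊗₁ id) ⨾ α ⨾ (id ⊗₁ α) ⨾ (id ⊗₁ λ⇒)  ≈⟨ prefix₃₂ pentagon ⟩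
    α ⨾ α ⨾ (id ⊗₁ λ⇒)                      ≈⟨ refl⟩⨾⟨ triangle ⟩
    α ⨾ (ρ⇒ ⊗₁ id)                          ≈⟨ α-natural-⊗id ⟨
    ((ρ⇒ ⊗₁ id) ⊗₁ id) ⨾ α                  ≈⟨ (triangle ⟩⊗⟨ refl) ⟩⨾⟨refl ⟨
    ((α ⨾ (id ⊗₁ λ⇒)) ⊗₁ id) ⨾ α            ≈⟨ prefix₁₂ (⊗id-distrib refl) ⟩
    (α ⊗₁ id) ⨾ ((id ⊗₁ λ⇒) ⊗₁ id) ⨾ α      ≈⟨ refl⟩⨾⟨ α-natural ⟩
    (α ⊗₁ id) ⨾ α ⨾ (id ⊗₁ (λ⇒ ⊗₁ id))      ∎)))

  kelly₁-α⁻ : α⁻ {I} {X} {Y} ⨾ (λ⇒ ⊗₁ id) ≈ λ⇒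
  kelly₁-α⁻ = trans (refl⟩⨾⟨ sym kelly₁) (cancelˡ α-iso₂)

  kelly₁-inv : λ⇐ ⨾ α⁻ ≈ λ⇐ {X} ⊗₁ id {Y}
  kelly₁-inv = inverse-of-⨾ kelly₁ (⊗id-inverse λ-iso₂) λ-iso₁ α-iso₁

  kelly₂ : α {X} {Y} {I} ⨾ (id ⊗₁ ρ⇒) ≈ ρ⇒
  kelly₂ = ⊗I-faithful (epic α-iso₁ (begin
    ((α ⨾ (id ⊗₁ ρ⇒)) ⊗₁ id) ⨾ α             ≈⟨ prefix₁₂ (⊗id-distrib refl) ⟩
    (α ⊗₁ id) ⨾ ((id ⊗₁ ρ⇒) ⊗₁ id) ⨾ α       ≈⟨ refl⟩⨾⟨ α-natural ⟩
    (α ⊗₁ id) ⨾ α ⨾ (id ⊗₁ (ρ⇒ ⊗₁ id))       ≈⟨ refl⟩⨾⟨ refl⟩⨾⟨ (refl ⟩⊗⟨ triangle) ⟨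
    (α ⊗₁ id) ⨾ α ⨾ (id ⊗₁ (α ⨾ (id ⊗₁ λ⇒))) ≈⟨ refl⟩⨾⟨ refl⟩⨾⟨ id⊗-distrib refl ⟩
    (α ⊗₁ id) ⨾ α ⨾ (id ⊗₁ α) ⨾ (id ⊗₁ (id ⊗₁ λ⇒)) ≈⟨ prefix₃₂ pentagon ⟩
    α ⨾ α ⨾ (id ⊗₁ (id ⊗₁ λ⇒))               ≈⟨ refl⟩⨾⟨ α-natural-id⊗ ⟩
    α ⨾ (id ⊗₁ λ⇒) ⨾ α                       ≈⟨ prefix₂₁ triangle ⟩
    (ρ⇒ ⊗₁ id) ⨾ α                           ∎))

  kelly₂-α⁻ : α⁻ ⨾ ρ⇒ {X ⊗₀ Y} ≈ id ⊗₁ ρ⇒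
  kelly₂-α⁻ = trans (refl⟩⨾⟨ sym kelly₂) (cancelˡ α-iso₂)

  kelly₂-inv : ρ⇐ ⨾ α ≈ id {X} ⊗₁ ρ⇐ {Y}
  kelly₂-inv = inverse-of-⨾ kelly₂-α⁻ (id⊗-inverse ρ-iso₂) ρ-iso₁ α-iso₂

  kelly₂-inv-α⁻ : ρ⇐ {X ⊗₀ Y} ≈ (id ⊗₁ ρ⇐) ⨾ α⁻
  kelly₂-inv-α⁻ = trans (sym (cancelʳ α-iso₁)) (prefix₂₁ kelly₂-inv)

  λ⇒≈ρ⇒ : λ⇒ {I} ≈ ρ⇒
  λ⇒≈ρ⇒ = ⊗I-faithful (begin
    λ⇒ ⊗₁ id       ≈⟨ kelly₁ ⟨
    α ⨾ λ⇒         ≈⟨ refl⟩⨾⟨ epic λ-iso₁ (sym λ-natural) ⟩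
    α ⨾ (id ⊗₁ λ⇒) ≈⟨ triangle ⟩
    ρ⇒ ⊗₁ id       ∎)

  λ⇐≈ρ⇐ : λ⇐ {I} ≈ ρ⇐
  λ⇐≈ρ⇐ = inverse-unique λ-iso₂ (trans (λ⇒≈ρ⇒ ⟩⨾⟨refl) ρ-iso₁)

  σ⨾λ⇒≈ρ⇒ : σ {X} {I} ⨾ λ⇒ ≈ ρ⇒
  σ⨾λ⇒≈ρ⇒ = I⊗-faithful (monic α-iso₂ (monic (⊗id-inverse σ-iso₂) (begin
    (σ ⊗₁ id) ⨾ α ⨾ (id ⊗₁ (σ ⨾ λ⇒))       ≈⟨ refl⟩⨾⟨ refl⟩⨾⟨ id⊗-distrib refl ⟩
    (σ ⊗₁ id) ⨾ α ⨾ (id ⊗₁ σ) ⨾ (id ⊗₁ λ⇒) ≈⟨ prefix₃₃ hexagon₁ ⟨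
    α ⨾ σ ⨾ α ⨾ (id ⊗₁ λ⇒)                 ≈⟨ refl⟩⨾⟨ refl⟩⨾⟨ triangle ⟩
    α ⨾ σ ⨾ (ρ⇒ ⊗₁ id)                     ≈⟨ refl⟩⨾⟨ σ-natural ⟨
    α ⨾ (id ⊗₁ ρ⇒) ⨾ σ                     ≈⟨ prefix₂₁ kelly₂ ⟩
    ρ⇒ ⨾ σ                                 ≈⟨ ρ-natural ⟨
    (σ ⊗₁ id) ⨾ ρ⇒                         ≈⟨ refl⟩⨾⟨ kelly₂ ⟨
    (σ ⊗₁ id) ⨾ α ⨾ (id ⊗₁ ρ⇒)             ∎)))

  σ⨾ρ⇒≈λ⇒ : σ {I} {X} ⨾ ρ⇒ ≈ λ⇒
  σ⨾ρ⇒≈λ⇒ = ⊗I-faithful (monic α-iso₁ (monic (id⊗-inverse σ-iso₂) (begin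
    (id ⊗₁ σ) ⨾ α⁻ ⨾ ((σ ⨾ ρ⇒) ⊗₁ id)       ≈⟨ refl⟩⨾⟨ refl⟩⨾⟨ ⊗id-distrib refl ⟩
    (id ⊗₁ σ) ⨾ α⁻ ⨾ (σ ⊗₁ id) ⨾ (ρ⇒ ⊗₁ id) ≈⟨ prefix₃₃ hexagon₂ ⟨
    α⁻ ⨾ σ ⨾ α⁻ ⨾ (ρ⇒ ⊗₁ id)                ≈⟨ refl⟩⨾⟨ refl⟩⨾⟨ triangle-α⁻ ⟩
    α⁻ ⨾ σ ⨾ (id ⊗₁ λ⇒)                     ≈⟨ refl⟩⨾⟨ σ-natural ⟨
    α⁻ ⨾ (λ⇒ ⊗₁ id) ⨾ σ                     ≈⟨ prefix₂₁ kelly₁-α⁻ ⟩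
    λ⇒ ⨾ σ                                  ≈⟨ λ-natural ⟨
    (id ⊗₁ σ) ⨾ λ⇒                          ≈⟨ refl⟩⨾⟨ kelly₁-α⁻ ⟨
    (id ⊗₁ σ) ⨾ α⁻ ⨾ (λ⇒ ⊗₁ id)             ∎)))

  σ⁻⨾ρ⇒≈λ⇒ : σ⁻ {X} {I} ⨾ ρ⇒ ≈ λ⇒
  σ⁻⨾ρ⇒≈λ⇒ = trans (refl⟩⨾⟨ sym σ⨾λ⇒≈ρ⇒) (cancelˡ σ-iso₂)

  σ⁻⨾λ⇒≈ρ⇒ : σ⁻ {I} {X} ⨾ λ⇒ ≈ ρ⇒
  σ⁻⨾λ⇒≈ρ⇒ = trans (refl⟩⨾⟨ sym σ⨾ρ⇒≈λ⇒) (cancelˡ σ-iso₂)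

  λ⇐⨾σ≈ρ⇐ : λ⇐ ⨾ σ {I} {X} ≈ ρ⇐
  λ⇐⨾σ≈ρ⇐ = inverse-of-⨾ σ⁻⨾λ⇒≈ρ⇒ ρ-iso₂ λ-iso₁ σ-iso₂

  hexagon⁻¹₁ : α⁻ ⨾ σ⁻ {X} {Y ⊗₀ Z} ⨾ α⁻ ≈ (id ⊗₁ σ⁻) ⨾ α⁻ ⨾ (σ⁻ ⊗₁ id)
  hexagon⁻¹₁ = inverse-of-⨾₃ hexagon₁ α-iso₂ σ-iso₂ α-iso₂
                             (⊗id-inverse σ-iso₁) α-iso₁ (id⊗-inverse σ-iso₁)

  hexagon⁻¹₂ : α ⨾ σ⁻ {X ⊗₀ Y} {Z} ⨾ α ≈ (σ⁻ ⊗₁ id) ⨾ α ⨾ (id ⊗₁ σ⁻)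
  hexagon⁻¹₂ = inverse-of-⨾₃ hexagon₂ α-iso₁ σ-iso₂ α-iso₁
                             (id⊗-inverse σ-iso₁) α-iso₂ (⊗id-inverse σ-iso₁)

  σ⁻⊗id-α-id⊗σ : (σ⁻ {Y} {X} ⊗₁ id {Z}) ⨾ α ⨾ (id ⊗₁ σ) ≈ σ ⨾ α⁻ ⨾ σ⁻
  σ⁻⊗id-α-id⊗σ = begin
    (σ⁻ ⊗₁ id) ⨾ α ⨾ (id ⊗₁ σ)
      ≈⟨ refl⟩⨾⟨ refl⟩⨾⟨ cancelʳ α-iso₂ ⟨
    (σ⁻ ⊗₁ id) ⨾ α ⨾ (id ⊗₁ σ) ⨾ α⁻ ⨾ α
      ≈⟨ refl⟩⨾⟨ refl⟩⨾⟨ refl⟩⨾⟨ refl⟩⨾⟨ cancelˡ (⊗id-inverse σ-iso₁) ⟨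
    (σ⁻ ⊗₁ id) ⨾ α ⨾ (id ⊗₁ σ) ⨾ α⁻ ⨾ (σ ⊗₁ id) ⨾ (σ⁻ ⊗₁ id) ⨾ α
      ≈⟨ refl⟩⨾⟨ refl⟩⨾⟨ prefix₃₃ hexagon₂ ⟨
    (σ⁻ ⊗₁ id) ⨾ α ⨾ α⁻ ⨾ σ ⨾ α⁻ ⨾ (σ⁻ ⊗₁ id) ⨾ α
      ≈⟨ refl⟩⨾⟨ cancelˡ α-iso₁ ⟩
    (σ⁻ ⊗₁ id) ⨾ σ ⨾ α⁻ ⨾ (σ⁻ ⊗₁ id) ⨾ α
      ≈⟨ prefix₂₂ σ-natural ⟩
    σ ⨾ (id ⊗₁ σ⁻) ⨾ α⁻ ⨾ (σ⁻ ⊗₁ id) ⨾ α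
      ≈⟨ refl⟩⨾⟨ prefix₃₃ hexagon⁻¹₁ ⟨
    σ ⨾ α⁻ ⨾ σ⁻ ⨾ α⁻ ⨾ α
      ≈⟨ refl⟩⨾⟨ refl⟩⨾⟨ cancelʳ α-iso₂ ⟩
    σ ⨾ α⁻ ⨾ σ⁻
      ∎

  -- Cups and caps

  cupʳ : I ⇒ (X ⊗₀ Y) → U ⇒ ((U ⊗₀ X) ⊗₀ Y)
  cupʳ c = ρ⇐ ⨾ (id ⊗₁ c) ⨾ α⁻

  capʳ : (X ⊗₀ Y) ⇒ I → ((U ⊗₀ X) ⊗₀ Y) ⇒ U
  capʳ d = α ⨾ (id ⊗₁ d) ⨾ ρ⇒

  cupʳ-natural : g ⨾ cupʳ c ≈ cupʳ c ⨾ ((g ⊗₁ id) ⊗₁ id)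
  cupʳ-natural {g = g} {c = c} = begin
    g ⨾ ρ⇐ ⨾ (id ⊗₁ c) ⨾ α⁻          ≈⟨ prefix₂₂ ρ⇐-natural ⟩
    ρ⇐ ⨾ (g ⊗₁ id) ⨾ (id ⊗₁ c) ⨾ α⁻  ≈⟨ refl⟩⨾⟨ prefix₂₂ interchange ⟩
    ρ⇐ ⨾ (id ⊗₁ c) ⨾ (g ⊗₁ id) ⨾ α⁻  ≈⟨ refl⟩⨾⟨ refl⟩⨾⟨ α⁻-natural-⊗id ⟩
    ρ⇐ ⨾ (id ⊗₁ c) ⨾ α⁻ ⨾ ((g ⊗₁ id) ⊗₁ id) ≈⟨ assoc₃ ⟨
    cupʳ c ⨾ ((g ⊗₁ id) ⊗₁ id)       ∎

  capʳ-natural : ((g ⊗₁ id) ⊗₁ id) ⨾ capʳ d ≈ capʳ d ⨾ g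
  capʳ-natural {g = g} {d = d} = begin
    ((g ⊗₁ id) ⊗₁ id) ⨾ α ⨾ (id ⊗₁ d) ⨾ ρ⇒ ≈⟨ prefix₂₂ α-natural-⊗id ⟩
    α ⨾ (g ⊗₁ id) ⨾ (id ⊗₁ d) ⨾ ρ⇒          ≈⟨ refl⟩⨾⟨ prefix₂₂ interchange ⟩
    α ⨾ (id ⊗₁ d) ⨾ (g ⊗₁ id) ⨾ ρ⇒          ≈⟨ refl⟩⨾⟨ refl⟩⨾⟨ ρ-natural ⟩
    α ⨾ (id ⊗₁ d) ⨾ ρ⇒ ⨾ g                  ≈⟨ assoc₃ ⟨
    capʳ d ⨾ g                              ∎

  capʳ⨾cupʳ : capʳ {U = U} d ⨾ cupʳ c ≈ α ⨾ (id ⊗₁ (d ⨾ c)) ⨾ α⁻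
  capʳ⨾cupʳ {d = d} {c = c} = begin
    (α ⨾ (id ⊗₁ d) ⨾ ρ⇒) ⨾ ρ⇐ ⨾ (id ⊗₁ c) ⨾ α⁻ ≈⟨ assoc₃ ⟩
    α ⨾ (id ⊗₁ d) ⨾ ρ⇒ ⨾ ρ⇐ ⨾ (id ⊗₁ c) ⨾ α⁻   ≈⟨ refl⟩⨾⟨ refl⟩⨾⟨ cancelˡ ρ-iso₁ ⟩
    α ⨾ (id ⊗₁ d) ⨾ (id ⊗₁ c) ⨾ α⁻             ≈⟨ refl⟩⨾⟨ prefix₁₂ (id⊗-distrib refl) ⟨
    α ⨾ (id ⊗₁ (d ⨾ c)) ⨾ α⁻                   ∎

  cupʳ-⊗ : cupʳ {U = W ⊗₀ U} c ⨾ (α ⊗₁ id) ≈ (id ⊗₁ cupʳ c) ⨾ α⁻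
  cupʳ-⊗ {c = c} = begin
    (ρ⇐ ⨾ (id ⊗₁ c) ⨾ α⁻) ⨾ (α ⊗₁ id)              ≈⟨ assoc₃ ⟩
    ρ⇐ ⨾ (id ⊗₁ c) ⨾ α⁻ ⨾ (α ⊗₁ id)                ≈⟨ prefix₁₂ kelly₂-inv-α⁻ ⟩
    (id ⊗₁ ρ⇐) ⨾ α⁻ ⨾ (id ⊗₁ c) ⨾ α⁻ ⨾ (α ⊗₁ id)   ≈⟨ refl⟩⨾⟨ prefix₂₂ α⁻-natural-id⊗ ⟩
    (id ⊗₁ ρ⇐) ⨾ (id ⊗₁ (id ⊗₁ c)) ⨾ α⁻ ⨾ α⁻ ⨾ (α ⊗₁ id) ≈⟨ refl⟩⨾⟨ refl⟩⨾⟨ refl⟩⨾⟨ pentagon-α⊗id ⟩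
    (id ⊗₁ ρ⇐) ⨾ (id ⊗₁ (id ⊗₁ c)) ⨾ α⁻ ⨾ α ⨾ (id ⊗₁ α⁻) ⨾ α⁻ ≈⟨ refl⟩⨾⟨ refl⟩⨾⟨ cancelˡ α-iso₂ ⟩
    (id ⊗₁ ρ⇐) ⨾ (id ⊗₁ (id ⊗₁ c)) ⨾ (id ⊗₁ α⁻) ⨾ α⁻ ≈⟨ prefix₁₃ (id⊗-distrib (id⊗-distrib refl)) ⟨
    (id ⊗₁ cupʳ c) ⨾ α⁻                            ∎

  capʳ-⊗ : (α⁻ ⊗₁ id) ⨾ capʳ {U = W ⊗₀ U} d ≈ α ⨾ (id ⊗₁ capʳ d)
  capʳ-⊗ {d = d} = begin
    (α⁻ ⊗₁ id) ⨾ α ⨾ (id ⊗₁ d) ⨾ ρ⇒                ≈⟨ prefix₂₃ pentagon-α⁻⊗id ⟩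
    α ⨾ (id ⊗₁ α) ⨾ α⁻ ⨾ (id ⊗₁ d) ⨾ ρ⇒             ≈⟨ refl⟩⨾⟨ refl⟩⨾⟨ prefix₂₂ α⁻-natural-id⊗ ⟩
    α ⨾ (id ⊗₁ α) ⨾ (id ⊗₁ (id ⊗₁ d)) ⨾ α⁻ ⨾ ρ⇒     ≈⟨ refl⟩⨾⟨ refl⟩⨾⟨ refl⟩⨾⟨ kelly₂-α⁻ ⟩
    α ⨾ (id ⊗₁ α) ⨾ (id ⊗₁ (id ⊗₁ d)) ⨾ (id ⊗₁ ρ⇒)  ≈⟨ refl⟩⨾⟨ id⊗-distrib (id⊗-distrib refl) ⟨
    α ⨾ (id ⊗₁ capʳ d)                            ∎

  cupʳ⊗id : (cupʳ c ⊗₁ id {Z}) ⨾ α ≈ (id {U} ⊗₁ (λ⇐ ⨾ (c ⊗₁ id) ⨾ α)) ⨾ α⁻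
  cupʳ⊗id {c = c} = begin
    (cupʳ c ⊗₁ id) ⨾ α                                  ≈⟨ prefix₁₃ (⊗id-distrib (⊗id-distrib refl)) ⟩
    (ρ⇐ ⊗₁ id) ⨾ ((id ⊗₁ c) ⊗₁ id) ⨾ (α⁻ ⊗₁ id) ⨾ α     ≈⟨ refl⟩⨾⟨ refl⟩⨾⟨ pentagon-α⁻⊗id ⟩
    (ρ⇐ ⊗₁ id) ⨾ ((id ⊗₁ c) ⊗₁ id) ⨾ α ⨾ (id ⊗₁ α) ⨾ α⁻ ≈⟨ refl⟩⨾⟨ prefix₂₂ α-natural ⟩
    (ρ⇐ ⊗₁ id) ⨾ α ⨾ (id ⊗₁ (c ⊗₁ id)) ⨾ (id ⊗₁ α) ⨾ α⁻ ≈⟨ prefix₂₁ triangle-ρ⇐ ⟩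
    (id ⊗₁ λ⇐) ⨾ (id ⊗₁ (c ⊗₁ id)) ⨾ (id ⊗₁ α) ⨾ α⁻     ≈⟨ prefix₁₃ (id⊗-distrib (id⊗-distrib refl)) ⟨
    (id ⊗₁ (λ⇐ ⨾ (c ⊗₁ id) ⨾ α)) ⨾ α⁻                   ∎

  capʳ⊗id : α⁻ ⨾ (capʳ d ⊗₁ id {Z}) ≈ α ⨾ (id {U} ⊗₁ (α⁻ ⨾ (d ⊗₁ id) ⨾ λ⇒))
  capʳ⊗id {d = d} = begin
    α⁻ ⨾ (capʳ d ⊗₁ id)                                 ≈⟨ refl⟩⨾⟨ ⊗id-distrib (⊗id-distrib refl) ⟩
    α⁻ ⨾ (α ⊗₁ id) ⨾ ((id ⊗₁ d) ⊗₁ id) ⨾ (ρ⇒ ⊗₁ id)     ≈⟨ prefix₂₃ pentagon-α⊗id ⟩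
    α ⨾ (id ⊗₁ α⁻) ⨾ α⁻ ⨾ ((id ⊗₁ d) ⊗₁ id) ⨾ (ρ⇒ ⊗₁ id) ≈⟨ refl⟩⨾⟨ refl⟩⨾⟨ prefix₂₂ α⁻-natural ⟨
    α ⨾ (id ⊗₁ α⁻) ⨾ (id ⊗₁ (d ⊗₁ id)) ⨾ α⁻ ⨾ (ρ⇒ ⊗₁ id) ≈⟨ refl⟩⨾⟨ refl⟩⨾⟨ refl⟩⨾⟨ triangle-α⁻ ⟩
    α ⨾ (id ⊗₁ α⁻) ⨾ (id ⊗₁ (d ⊗₁ id)) ⨾ (id ⊗₁ λ⇒)     ≈⟨ refl⟩⨾⟨ id⊗-distrib (id⊗-distrib refl) ⟨
    α ⨾ (id ⊗₁ (α⁻ ⨾ (d ⊗₁ id) ⨾ λ⇒))                   ∎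

  id⊗-factor : (cupʳ c ⊗₁ id) ⨾ α ⨾ (id ⊗₁ m) ⨾ α⁻ ⨾ (capʳ d ⊗₁ id)
               ≈ id {U} ⊗₁ (λ⇐ ⨾ (c ⊗₁ id) ⨾ α ⨾ (id ⊗₁ m) ⨾ α⁻ ⨾ (d ⊗₁ id) ⨾ λ⇒)
  id⊗-factor {c = c} {m = m} {d = d} = begin
    (cupʳ c ⊗₁ id) ⨾ α ⨾ (id ⊗₁ m) ⨾ α⁻ ⨾ (capʳ d ⊗₁ id)
      ≈⟨ prefix₂₂ cupʳ⊗id ⟩
    (id ⊗₁ (λ⇐ ⨾ (c ⊗₁ id) ⨾ α)) ⨾ α⁻ ⨾ (id ⊗₁ m) ⨾ α⁻ ⨾ (capʳ d ⊗₁ id)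
      ≈⟨ refl⟩⨾⟨ refl⟩⨾⟨ refl⟩⨾⟨ capʳ⊗id ⟩
    (id ⊗₁ (λ⇐ ⨾ (c ⊗₁ id) ⨾ α)) ⨾ α⁻ ⨾ (id ⊗₁ m) ⨾ α ⨾ (id ⊗₁ (α⁻ ⨾ (d ⊗₁ id) ⨾ λ⇒))
      ≈⟨ refl⟩⨾⟨ prefix₂₂ α⁻-natural-id⊗ ⟩
    (id ⊗₁ (λ⇐ ⨾ (c ⊗₁ id) ⨾ α)) ⨾ (id ⊗₁ (id ⊗₁ m)) ⨾ α⁻ ⨾ α ⨾ (id ⊗₁ (α⁻ ⨾ (d ⊗₁ id) ⨾ λ⇒))
      ≈⟨ refl⟩⨾⟨ refl⟩⨾⟨ cancelˡ α-iso₂ ⟩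
    (id ⊗₁ (λ⇐ ⨾ (c ⊗₁ id) ⨾ α)) ⨾ (id ⊗₁ (id ⊗₁ m)) ⨾ (id ⊗₁ (α⁻ ⨾ (d ⊗₁ id) ⨾ λ⇒))
      ≈⟨ id⊗-distrib (id⊗-distrib refl) ⟨
    id ⊗₁ ((λ⇐ ⨾ (c ⊗₁ id) ⨾ α) ⨾ (id ⊗₁ m) ⨾ α⁻ ⨾ (d ⊗₁ id) ⨾ λ⇒)
      ≈⟨ refl ⟩⊗⟨ assoc₃ ⟩
    id ⊗₁ (λ⇐ ⨾ (c ⊗₁ id) ⨾ α ⨾ (id ⊗₁ m) ⨾ α⁻ ⨾ (d ⊗₁ id) ⨾ λ⇒)
      ∎

  capʳ-cancel-middle : f ⨾ f′ ≈ id →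
                       ((c ⨾ (id ⊗₁ f)) ⊗₁ id) ⨾ capʳ ((f′ ⊗₁ id) ⨾ d) ≈ (c ⊗₁ id) ⨾ capʳ d
  capʳ-cancel-middle {f = f} {f′ = f′} {c = c} {d = d} ff′ = begin
    ((c ⨾ (id ⊗₁ f)) ⊗₁ id) ⨾ α ⨾ (id ⊗₁ ((f′ ⊗₁ id) ⨾ d)) ⨾ ρ⇒
      ≈⟨ prefix₁₂ (⊗id-distrib refl) ⟩
    (c ⊗₁ id) ⨾ ((id ⊗₁ f) ⊗₁ id) ⨾ α ⨾ (id ⊗₁ ((f′ ⊗₁ id) ⨾ d)) ⨾ ρ⇒
      ≈⟨ refl⟩⨾⟨ prefix₂₂ α-natural ⟩
    (c ⊗₁ id) ⨾ α ⨾ (id ⊗₁ (f ⊗₁ id)) ⨾ (id ⊗₁ ((f′ ⊗₁ id) ⨾ d)) ⨾ ρ⇒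
      ≈⟨ refl⟩⨾⟨ refl⟩⨾⟨ refl⟩⨾⟨ prefix₁₂ (id⊗-distrib refl) ⟩
    (c ⊗₁ id) ⨾ α ⨾ (id ⊗₁ (f ⊗₁ id)) ⨾ (id ⊗₁ (f′ ⊗₁ id)) ⨾ (id ⊗₁ d) ⨾ ρ⇒
      ≈⟨ refl⟩⨾⟨ refl⟩⨾⟨ cancelˡ (id⊗-inverse (⊗id-inverse ff′)) ⟩
    (c ⊗₁ id) ⨾ α ⨾ (id ⊗₁ d) ⨾ ρ⇒
      ∎

  -- Duality and twist

  snake₁-naturalˡ : λ⇐ ⨾ (η Y ⊗₁ id) ⨾ capʳ ((id ⊗₁ f) ⨾ ε Y) ≈ f
  snake₁-naturalˡ {Y = Y} {f = f} = begin
    λ⇐ ⨾ (η Y ⊗₁ id) ⨾ α ⨾ (id ⊗₁ ((id ⊗₁ f) ⨾ ε Y)) ⨾ ρ⇒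
      ≈⟨ refl⟩⨾⟨ refl⟩⨾⟨ refl⟩⨾⟨ prefix₁₂ (id⊗-distrib refl) ⟩
    λ⇐ ⨾ (η Y ⊗₁ id) ⨾ α ⨾ (id ⊗₁ (id ⊗₁ f)) ⨾ (id ⊗₁ ε Y) ⨾ ρ⇒ ≈⟨ refl⟩⨾⟨ refl⟩⨾⟨ prefix₂₂ α-natural-id⊗ ⟩
    λ⇐ ⨾ (η Y ⊗₁ id) ⨾ (id ⊗₁ f) ⨾ α ⨾ (id ⊗₁ ε Y) ⨾ ρ⇒         ≈⟨ refl⟩⨾⟨ prefix₂₂ interchange ⟩
    λ⇐ ⨾ (id ⊗₁ f) ⨾ (η Y ⊗₁ id) ⨾ α ⨾ (id ⊗₁ ε Y) ⨾ ρ⇒         ≈⟨ prefix₂₂ λ⇐-natural ⟨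
    f ⨾ λ⇐ ⨾ (η Y ⊗₁ id) ⨾ α ⨾ (id ⊗₁ ε Y) ⨾ ρ⇒                 ≈⟨ refl⟩⨾⟨ snake₁ ⟩
    f ⨾ id                                                     ≈⟨ identityʳ ⟩
    f                                                          ∎

  snake₁-naturalʳ : λ⇐ ⨾ ((η X ⨾ (f ⊗₁ id)) ⊗₁ id) ⨾ capʳ (ε X) ≈ f
  snake₁-naturalʳ {X = X} {f = f} = begin
    λ⇐ ⨾ ((η X ⨾ (f ⊗₁ id)) ⊗₁ id) ⨾ capʳ (ε X)     ≈⟨ refl⟩⨾⟨ prefix₁₂ (⊗id-distrib refl) ⟩
    λ⇐ ⨾ (η X ⊗₁ id) ⨾ ((f ⊗₁ id) ⊗₁ id) ⨾ capʳ (ε X) ≈⟨ refl⟩⨾⟨ refl⟩⨾⟨ capʳ-natural ⟩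
    λ⇐ ⨾ (η X ⊗₁ id) ⨾ capʳ (ε X) ⨾ f                ≈⟨ prefix₃₁ snake₁ ⟩
    id ⨾ f                                          ≈⟨ identityˡ ⟩
    f                                               ∎

  snake₁-natural-⊗id :
    λ⇐ ⨾ (η Y ⊗₁ id) ⨾ α ⨾ (id ⊗₁ (α⁻ ⨾ ((id ⊗₁ f) ⊗₁ id) ⨾ (ε Y ⊗₁ id) ⨾ λ⇒)) ≈ f ⊗₁ id {Z}
  snake₁-natural-⊗id {Y = Y} {f = f} = begin
    λ⇐ ⨾ (η Y ⊗₁ id) ⨾ α ⨾ (id ⊗₁ (α⁻ ⨾ ((id ⊗₁ f) ⊗₁ id) ⨾ (ε Y ⊗₁ id) ⨾ λ⇒))
      ≈⟨ refl⟩⨾⟨ refl⟩⨾⟨ refl⟩⨾⟨ (refl ⟩⊗⟨ (refl⟩⨾⟨ prefix₂₁ (sym (⊗id-distrib refl)))) ⟩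
    λ⇐ ⨾ (η Y ⊗₁ id) ⨾ α ⨾ (id ⊗₁ (α⁻ ⨾ (((id ⊗₁ f) ⨾ ε Y) ⊗₁ id) ⨾ λ⇒))
      ≈⟨ refl⟩⨾⟨ refl⟩⨾⟨ capʳ⊗id ⟨
    λ⇐ ⨾ (η Y ⊗₁ id) ⨾ α⁻ ⨾ (capʳ ((id ⊗₁ f) ⨾ ε Y) ⊗₁ id)
      ≈⟨ refl⟩⨾⟨ prefix₂₂ α⁻-natural-⊗id ⟩
    λ⇐ ⨾ α⁻ ⨾ ((η Y ⊗₁ id) ⊗₁ id) ⨾ (capʳ ((id ⊗₁ f) ⨾ ε Y) ⊗₁ id)
      ≈⟨ prefix₂₁ kelly₁-inv ⟩
    (λ⇐ ⊗₁ id) ⨾ ((η Y ⊗₁ id) ⊗₁ id) ⨾ (capʳ ((id ⊗₁ f) ⨾ ε Y) ⊗₁ id)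
      ≈⟨ ⊗id-distrib (⊗id-distrib refl) ⟨
    (λ⇐ ⨾ (η Y ⊗₁ id) ⨾ capʳ ((id ⊗₁ f) ⨾ ε Y)) ⊗₁ id
      ≈⟨ snake₁-naturalˡ ⟩⊗⟨ refl ⟩
    f ⊗₁ id
      ∎

  η-dual : η Y ⨾ (id ⊗₁ dual f) ≈ η X ⨾ (f ⊗₁ id)
  η-dual {Y = Y} {X = X} {f = f} = begin
    η Y ⨾ (id ⊗₁ (ρ⇐ ⨾ (id ⊗₁ η X) ⨾ ε-after-f))
      ≈⟨ refl⟩⨾⟨ id⊗-distrib (id⊗-distrib refl) ⟩
    η Y ⨾ (id ⊗₁ ρ⇐) ⨾ (id ⊗₁ (id ⊗₁ η X)) ⨾ (id ⊗₁ ε-after-f) ≈⟨ refl⟩⨾⟨ prefix₂₁ kelly₂-inv ⟨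
    η Y ⨾ ρ⇐ ⨾ α ⨾ (id ⊗₁ (id ⊗₁ η X)) ⨾ (id ⊗₁ ε-after-f)     ≈⟨ refl⟩⨾⟨ refl⟩⨾⟨ prefix₂₂ α-natural-id⊗ ⟩
    η Y ⨾ ρ⇐ ⨾ (id ⊗₁ η X) ⨾ α ⨾ (id ⊗₁ ε-after-f)            ≈⟨ prefix₂₂ ρ⇐-natural ⟩
    ρ⇐ ⨾ (η Y ⊗₁ id) ⨾ (id ⊗₁ η X) ⨾ α ⨾ (id ⊗₁ ε-after-f)    ≈⟨ refl⟩⨾⟨ prefix₂₂ interchange ⟩
    ρ⇐ ⨾ (id ⊗₁ η X) ⨾ (η Y ⊗₁ id) ⨾ α ⨾ (id ⊗₁ ε-after-f)    ≈⟨ λ⇐≈ρ⇐ ⟩⨾⟨refl ⟨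
    λ⇐ ⨾ (id ⊗₁ η X) ⨾ (η Y ⊗₁ id) ⨾ α ⨾ (id ⊗₁ ε-after-f)    ≈⟨ prefix₂₂ λ⇐-natural ⟨
    η X ⨾ λ⇐ ⨾ (η Y ⊗₁ id) ⨾ α ⨾ (id ⊗₁ ε-after-f)            ≈⟨ refl⟩⨾⟨ snake₁-natural-⊗id ⟩
    η X ⨾ (f ⊗₁ id)                                       ∎
    where
    ε-after-f : ((Y *) ⊗₀ (X ⊗₀ (X *))) ⇒ (X *)
    ε-after-f = α⁻ ⨾ ((id ⊗₁ f) ⊗₁ id) ⨾ (ε Y ⊗₁ id) ⨾ λ⇒

  θ-slide : η X ⨾ (id ⊗₁ θ) ≈ η X ⨾ (θ ⊗₁ id)
  θ-slide = trans (refl⟩⨾⟨ (refl ⟩⊗⟨ sym θ-dual)) η-dual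

  θ⁻-slide : η X ⨾ (id ⊗₁ θ⁻) ≈ η X ⨾ (θ⁻ ⊗₁ id)
  θ⁻-slide {X = X} = begin
    η X ⨾ (id ⊗₁ θ⁻)                              ≈⟨ refl⟩⨾⟨ cancelˡ (⊗id-inverse θ-iso₁) ⟨
    η X ⨾ (θ ⊗₁ id) ⨾ (θ⁻ ⊗₁ id) ⨾ (id ⊗₁ θ⁻)     ≈⟨ prefix₂₂ θ-slide ⟨
    η X ⨾ (id ⊗₁ θ) ⨾ (θ⁻ ⊗₁ id) ⨾ (id ⊗₁ θ⁻)     ≈⟨ refl⟩⨾⟨ prefix₂₂ interchange ⟨
    η X ⨾ (θ⁻ ⊗₁ id) ⨾ (id ⊗₁ θ) ⨾ (id ⊗₁ θ⁻)     ≈⟨ refl⟩⨾⟨ cancelʳ (id⊗-inverse θ-iso₁) ⟩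
    η X ⨾ (θ⁻ ⊗₁ id)                              ∎

  cupʳ-η-ε : cupʳ (η X) ⨾ (ε X ⊗₁ id) ≈ λ⇐
  cupʳ-η-ε = inverse-unique (trans ⨾-assoc (trans assoc₃ snake₂)) λ-iso₁

  -- X * is a right dual of X as well (snakeʳ); evʳ X is the cap in Tr and coevʳ A the cup in lam.
  coevʳ : ∀ X → I ⇒ ((X *) ⊗₀ X)
  coevʳ X = η X ⨾ (id ⊗₁ θ⁻) ⨾ σ⁻

  evʳ : ∀ X → (X ⊗₀ (X *)) ⇒ I
  evʳ X = σ ⨾ (id ⊗₁ θ) ⨾ ε X

  coevʳ-untwist : coevʳ X ≈ (η X ⨾ σ⁻) ⨾ (id ⊗₁ θ⁻)
  coevʳ-untwist {X = X} = begin
    η X ⨾ (id ⊗₁ θ⁻) ⨾ σ⁻   ≈⟨ prefix₂₂ θ⁻-slide ⟩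
    η X ⨾ (θ⁻ ⊗₁ id) ⨾ σ⁻   ≈⟨ refl⟩⨾⟨ σ⁻-natural ⟩
    η X ⨾ σ⁻ ⨾ (id ⊗₁ θ⁻)   ≈⟨ ⨾-assoc ⟨
    (η X ⨾ σ⁻) ⨾ (id ⊗₁ θ⁻) ∎

  evʳ-untwist : evʳ X ≈ (θ ⊗₁ id) ⨾ σ ⨾ ε X
  evʳ-untwist = prefix₂₂ (sym σ-natural)

  braided-snake : λ⇐ ⨾ ((η X ⨾ σ⁻) ⊗₁ id) ⨾ capʳ (σ ⨾ ε X) ≈ id
  braided-snake {X = X} = begin
    λ⇐ ⨾ ((η X ⨾ σ⁻) ⊗₁ id) ⨾ α ⨾ (id ⊗₁ (σ ⨾ ε X)) ⨾ ρ⇒ ≈⟨ refl⟩⨾⟨ prefix₁₂ (⊗id-distrib refl) ⟩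
    λ⇐ ⨾ (η X ⊗₁ id) ⨾ (σ⁻ ⊗₁ id) ⨾ α ⨾ (id ⊗₁ (σ ⨾ ε X)) ⨾ ρ⇒
      ≈⟨ refl⟩⨾⟨ refl⟩⨾⟨ refl⟩⨾⟨ refl⟩⨾⟨ prefix₁₂ (id⊗-distrib refl) ⟩
    λ⇐ ⨾ (η X ⊗₁ id) ⨾ (σ⁻ ⊗₁ id) ⨾ α ⨾ (id ⊗₁ σ) ⨾ (id ⊗₁ ε X) ⨾ ρ⇒
      ≈⟨ refl⟩⨾⟨ refl⟩⨾⟨ prefix₃₃ σ⁻⊗id-α-id⊗σ ⟩
    λ⇐ ⨾ (η X ⊗₁ id) ⨾ σ ⨾ α⁻ ⨾ σ⁻ ⨾ (id ⊗₁ ε X) ⨾ ρ⇒    ≈⟨ refl⟩⨾⟨ prefix₂₂ σ-natural ⟩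
    λ⇐ ⨾ σ ⨾ (id ⊗₁ η X) ⨾ α⁻ ⨾ σ⁻ ⨾ (id ⊗₁ ε X) ⨾ ρ⇒
      ≈⟨ refl⟩⨾⟨ refl⟩⨾⟨ refl⟩⨾⟨ refl⟩⨾⟨ prefix₂₂ σ⁻-natural ⟨
    λ⇐ ⨾ σ ⨾ (id ⊗₁ η X) ⨾ α⁻ ⨾ (ε X ⊗₁ id) ⨾ σ⁻ ⨾ ρ⇒
      ≈⟨ refl⟩⨾⟨ refl⟩⨾⟨ refl⟩⨾⟨ refl⟩⨾⟨ refl⟩⨾⟨ σ⁻⨾ρ⇒≈λ⇒ ⟩
    λ⇐ ⨾ σ ⨾ (id ⊗₁ η X) ⨾ α⁻ ⨾ (ε X ⊗₁ id) ⨾ λ⇒         ≈⟨ prefix₂₁ λ⇐⨾σ≈ρ⇐ ⟩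
    ρ⇐ ⨾ (id ⊗₁ η X) ⨾ α⁻ ⨾ (ε X ⊗₁ id) ⨾ λ⇒             ≈⟨ snake₂ ⟩
    id                                                  ∎

  snakeʳ : λ⇐ ⨾ (coevʳ X ⊗₁ id) ⨾ capʳ (evʳ X) ≈ id
  snakeʳ {X = X} = begin
    λ⇐ ⨾ (coevʳ X ⊗₁ id) ⨾ capʳ (evʳ X)
      ≈⟨ refl⟩⨾⟨ (coevʳ-untwist ⟩⊗⟨ refl) ⟩⨾⟨ refl⟩⨾⟨ (refl ⟩⊗⟨ evʳ-untwist) ⟩⨾⟨refl ⟩
    λ⇐ ⨾ (((η X ⨾ σ⁻) ⨾ (id ⊗₁ θ⁻)) ⊗₁ id) ⨾ capʳ ((θ ⊗₁ id) ⨾ σ ⨾ ε X)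
      ≈⟨ refl⟩⨾⟨ capʳ-cancel-middle θ-iso₂ ⟩
    λ⇐ ⨾ ((η X ⨾ σ⁻) ⊗₁ id) ⨾ capʳ (σ ⨾ ε X)
      ≈⟨ braided-snake ⟩
    id ∎

  -- Reidemeister I for ribbons: the left-hand side is a curl with a negative crossing.
  negative-kink : λ⇐ ⨾ (coevʳ X ⊗₁ id) ⨾ α ⨾ (id ⊗₁ σ⁻) ⨾ α⁻ ⨾ (ε X ⊗₁ id) ⨾ λ⇒ ≈ θ⁻
  negative-kink {X = X} = begin
    λ⇐ ⨾ (coevʳ X ⊗₁ id) ⨾ α ⨾ (id ⊗₁ σ⁻) ⨾ α⁻ ⨾ (ε X ⊗₁ id) ⨾ λ⇒
      ≈⟨ refl⟩⨾⟨ prefix₁₂ (trans (sym ⨾-assoc ⟩⊗⟨ refl) (⊗id-distrib refl)) ⟩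
    λ⇐ ⨾ ((η X ⨾ (id ⊗₁ θ⁻)) ⊗₁ id) ⨾ (σ⁻ ⊗₁ id) ⨾ α ⨾ (id ⊗₁ σ⁻) ⨾ α⁻ ⨾ (ε X ⊗₁ id) ⨾ λ⇒
      ≈⟨ refl⟩⨾⟨ refl⟩⨾⟨ prefix₃₃ hexagon⁻¹₂ ⟨
    λ⇐ ⨾ ((η X ⨾ (id ⊗₁ θ⁻)) ⊗₁ id) ⨾ α ⨾ σ⁻ ⨾ α ⨾ α⁻ ⨾ (ε X ⊗₁ id) ⨾ λ⇒
      ≈⟨ refl⟩⨾⟨ refl⟩⨾⟨ refl⟩⨾⟨ refl⟩⨾⟨ cancelˡ α-iso₁ ⟩
    λ⇐ ⨾ ((η X ⨾ (id ⊗₁ θ⁻)) ⊗₁ id) ⨾ α ⨾ σ⁻ ⨾ (ε X ⊗₁ id) ⨾ λ⇒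
      ≈⟨ refl⟩⨾⟨ refl⟩⨾⟨ refl⟩⨾⟨ prefix₂₂ σ⁻-natural ⟨
    λ⇐ ⨾ ((η X ⨾ (id ⊗₁ θ⁻)) ⊗₁ id) ⨾ α ⨾ (id ⊗₁ ε X) ⨾ σ⁻ ⨾ λ⇒
      ≈⟨ refl⟩⨾⟨ refl⟩⨾⟨ refl⟩⨾⟨ refl⟩⨾⟨ σ⁻⨾λ⇒≈ρ⇒ ⟩
    λ⇐ ⨾ ((η X ⨾ (id ⊗₁ θ⁻)) ⊗₁ id) ⨾ capʳ (ε X)
      ≈⟨ refl⟩⨾⟨ (θ⁻-slide ⟩⊗⟨ refl) ⟩⨾⟨refl ⟩
    λ⇐ ⨾ ((η X ⨾ (θ⁻ ⊗₁ id)) ⊗₁ id) ⨾ capʳ (ε X)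
      ≈⟨ snake₁-naturalʳ ⟩
    θ⁻ ∎

  -- Trace

  Tr-unfold : Tr C f ≈ cupʳ (η X) ⨾ (f ⊗₁ id) ⨾ capʳ (evʳ X)
  Tr-unfold = sym assoc₃

  Tr-resp-≈ : f ≈ g → Tr C {U} {V} {X} f ≈ Tr C g
  Tr-resp-≈ p = refl⟩⨾⟨ refl⟩⨾⟨ refl⟩⨾⟨ (p ⟩⊗⟨ refl) ⟩⨾⟨refl

  Tr-natural : Tr C ((g ⊗₁ id) ⨾ h ⨾ (g′ ⊗₁ id {X})) ≈ g ⨾ Tr C h ⨾ g′
  Tr-natural {g = g} {X = X} {h = h} {g′ = g′} = begin
    Tr C ((g ⊗₁ id) ⨾ h ⨾ (g′ ⊗₁ id))
      ≈⟨ Tr-unfold ⟩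
    cupʳ (η X) ⨾ (((g ⊗₁ id) ⨾ h ⨾ (g′ ⊗₁ id)) ⊗₁ id) ⨾ capʳ (evʳ X)
      ≈⟨ refl⟩⨾⟨ prefix₁₃ (⊗id-distrib (⊗id-distrib refl)) ⟩
    cupʳ (η X) ⨾ ((g ⊗₁ id) ⊗₁ id) ⨾ (h ⊗₁ id) ⨾ ((g′ ⊗₁ id) ⊗₁ id) ⨾ capʳ (evʳ X)
      ≈⟨ prefix₂₂ cupʳ-natural ⟨
    g ⨾ cupʳ (η X) ⨾ (h ⊗₁ id) ⨾ ((g′ ⊗₁ id) ⊗₁ id) ⨾ capʳ (evʳ X)
      ≈⟨ refl⟩⨾⟨ refl⟩⨾⟨ refl⟩⨾⟨ capʳ-natural ⟩
    g ⨾ cupʳ (η X) ⨾ (h ⊗₁ id) ⨾ capʳ (evʳ X) ⨾ g′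
      ≈⟨ refl⟩⨾⟨ prefix₁₃ Tr-unfold ⟨
    g ⨾ Tr C h ⨾ g′
      ∎

  Tr-superposing : Tr C (α ⨾ (id {W} ⊗₁ k) ⨾ α⁻) ≈ id ⊗₁ Tr C {U} {V} {X} k
  Tr-superposing {X = X} {k = k} = begin
    Tr C (α ⨾ (id ⊗₁ k) ⨾ α⁻)
      ≈⟨ Tr-unfold ⟩
    cupʳ (η X) ⨾ ((α ⨾ (id ⊗₁ k) ⨾ α⁻) ⊗₁ id) ⨾ capʳ (evʳ X)
      ≈⟨ refl⟩⨾⟨ prefix₁₃ (⊗id-distrib (⊗id-distrib refl)) ⟩
    cupʳ (η X) ⨾ (α ⊗₁ id) ⨾ ((id ⊗₁ k) ⊗₁ id) ⨾ (α⁻ ⊗₁ id) ⨾ capʳ (evʳ X)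
      ≈⟨ prefix₂₂ cupʳ-⊗ ⟩
    (id ⊗₁ cupʳ (η X)) ⨾ α⁻ ⨾ ((id ⊗₁ k) ⊗₁ id) ⨾ (α⁻ ⊗₁ id) ⨾ capʳ (evʳ X)
      ≈⟨ refl⟩⨾⟨ prefix₂₂ α⁻-natural ⟨
    (id ⊗₁ cupʳ (η X)) ⨾ (id ⊗₁ (k ⊗₁ id)) ⨾ α⁻ ⨾ (α⁻ ⊗₁ id) ⨾ capʳ (evʳ X)
      ≈⟨ refl⟩⨾⟨ refl⟩⨾⟨ refl⟩⨾⟨ capʳ-⊗ ⟩
    (id ⊗₁ cupʳ (η X)) ⨾ (id ⊗₁ (k ⊗₁ id)) ⨾ α⁻ ⨾ α ⨾ (id ⊗₁ capʳ (evʳ X))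
      ≈⟨ refl⟩⨾⟨ refl⟩⨾⟨ cancelˡ α-iso₂ ⟩
    (id ⊗₁ cupʳ (η X)) ⨾ (id ⊗₁ (k ⊗₁ id)) ⨾ (id ⊗₁ capʳ (evʳ X))
      ≈⟨ id⊗-distrib (id⊗-distrib refl) ⟨
    id ⊗₁ (cupʳ (η X) ⨾ (k ⊗₁ id) ⨾ capʳ (evʳ X))
      ≈⟨ refl ⟩⊗⟨ Tr-unfold ⟨
    id ⊗₁ Tr C k
      ∎

  Tr-ε⨾coevʳ : Tr C (ε X ⨾ coevʳ X) ≈ id
  Tr-ε⨾coevʳ {X = X} = begin
    Tr C (ε X ⨾ coevʳ X)                                         ≈⟨ Tr-unfold ⟩
    cupʳ (η X) ⨾ ((ε X ⨾ coevʳ X) ⊗₁ id) ⨾ capʳ (evʳ X)          ≈⟨ refl⟩⨾⟨ prefix₁₂ (⊗id-distrib refl) ⟩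
    cupʳ (η X) ⨾ (ε X ⊗₁ id) ⨾ (coevʳ X ⊗₁ id) ⨾ capʳ (evʳ X)    ≈⟨ prefix₂₁ cupʳ-η-ε ⟩
    λ⇐ ⨾ (coevʳ X ⊗₁ id) ⨾ capʳ (evʳ X)                          ≈⟨ snakeʳ ⟩
    id                                                          ∎

  module Reflexive (R : ReflexiveObject C) where
    open ReflexiveObject R

    lam-unfold : lam C R ≈ cupʳ (coevʳ A) ⨾ (φ ⊗₁ id)
    lam-unfold = begin
      ρ⇐ ⨾ (id ⊗₁ η A) ⨾ (id ⊗₁ (id ⊗₁ θ⁻)) ⨾ (id ⊗₁ σ⁻) ⨾ α⁻ ⨾ (φ ⊗₁ id)
        ≈⟨ refl⟩⨾⟨ prefix₁₃ (id⊗-distrib (id⊗-distrib refl)) ⟨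
      ρ⇐ ⨾ (id ⊗₁ coevʳ A) ⨾ α⁻ ⨾ (φ ⊗₁ id)
        ≈⟨ assoc₃ ⟨
      cupʳ (coevʳ A) ⨾ (φ ⊗₁ id)
        ∎

    app⨾lam : app C R ⨾ lam C R ≈ (φ⁻ ⊗₁ id) ⨾ (α ⨾ (id ⊗₁ (ε A ⨾ coevʳ A)) ⨾ α⁻) ⨾ (φ ⊗₁ id)
    app⨾lam = begin
      ((φ⁻ ⊗₁ id) ⨾ capʳ (ε A)) ⨾ lam C R                    ≈⟨ ⨾-assoc ⟩
      (φ⁻ ⊗₁ id) ⨾ capʳ (ε A) ⨾ lam C R                      ≈⟨ refl⟩⨾⟨ refl⟩⨾⟨ lam-unfold ⟩
      (φ⁻ ⊗₁ id) ⨾ capʳ (ε A) ⨾ cupʳ (coevʳ A) ⨾ (φ ⊗₁ id)   ≈⟨ refl⟩⨾⟨ prefix₂₁ capʳ⨾cupʳ ⟩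
      (φ⁻ ⊗₁ id) ⨾ (α ⨾ (id ⊗₁ (ε A ⨾ coevʳ A)) ⨾ α⁻) ⨾ (φ ⊗₁ id)  ∎

    β-law : (lam C R ⊗₁ id) ⨾ α ⨾ (id ⊗₁ σ⁻) ⨾ α⁻ ⨾ (app C R ⊗₁ id) ≈ id ⊗₁ θ⁻
    β-law = begin
      (lam C R ⊗₁ id) ⨾ α ⨾ (id ⊗₁ σ⁻) ⨾ α⁻ ⨾ (app C R ⊗₁ id)
        ≈⟨ prefix₁₂ (trans (lam-unfold ⟩⊗⟨ refl) (⊗id-distrib refl)) ⟩
      (cupʳ (coevʳ A) ⊗₁ id) ⨾ ((φ ⊗₁ id) ⊗₁ id) ⨾ α ⨾ (id ⊗₁ σ⁻) ⨾ α⁻ ⨾ (app C R ⊗₁ id)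
        ≈⟨ refl⟩⨾⟨ refl⟩⨾⟨ refl⟩⨾⟨ refl⟩⨾⟨ refl⟩⨾⟨ ⊗id-distrib refl ⟩
      (cupʳ (coevʳ A) ⊗₁ id) ⨾ ((φ ⊗₁ id) ⊗₁ id) ⨾ α ⨾ (id ⊗₁ σ⁻) ⨾ α⁻ ⨾ ((φ⁻ ⊗₁ id) ⊗₁ id) ⨾ (capʳ (ε A) ⊗₁ id)
        ≈⟨ refl⟩⨾⟨ cancel-around-id⊗ φ-iso₁ ⟩
      (cupʳ (coevʳ A) ⊗₁ id) ⨾ α ⨾ (id ⊗₁ σ⁻) ⨾ α⁻ ⨾ (capʳ (ε A) ⊗₁ id)
        ≈⟨ id⊗-factor ⟩
      id ⊗₁ (λ⇐ ⨾ (coevʳ A ⊗₁ id) ⨾ α ⨾ (id ⊗₁ σ⁻) ⨾ α⁻ ⨾ (ε A ⊗₁ id) ⨾ λ⇒)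
        ≈⟨ refl ⟩⊗⟨ negative-kink ⟩
      id ⊗₁ θ⁻
        ∎

    η-law : Tr C (app C R ⨾ lam C R) ≈ id
    η-law = begin
      Tr C (app C R ⨾ lam C R)
        ≈⟨ Tr-resp-≈ app⨾lam ⟩
      Tr C ((φ⁻ ⊗₁ id) ⨾ (α ⨾ (id ⊗₁ (ε A ⨾ coevʳ A)) ⨾ α⁻) ⨾ (φ ⊗₁ id))
        ≈⟨ Tr-natural ⟩
      φ⁻ ⨾ Tr C (α ⨾ (id ⊗₁ (ε A ⨾ coevʳ A)) ⨾ α⁻) ⨾ φ
        ≈⟨ refl⟩⨾⟨ Tr-superposing ⟩⨾⟨refl ⟩
      φ⁻ ⨾ (id ⊗₁ Tr C (ε A ⨾ coevʳ A)) ⨾ φ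
        ≈⟨ refl⟩⨾⟨ (refl ⟩⊗⟨ Tr-ε⨾coevʳ) ⟩⨾⟨refl ⟩
      φ⁻ ⨾ (id ⊗₁ id) ⨾ φ
        ≈⟨ refl⟩⨾⟨ ⊗-id ⟩⨾⟨refl ⟩
      φ⁻ ⨾ id ⨾ φ
        ≈⟨ refl⟩⨾⟨ identityˡ ⟩
      φ⁻ ⨾ φ
        ≈⟨ φ-iso₂ ⟩
      id
        ∎

lemma4p1 : ∀ {o ℓ e} (C : RibbonCategory o ℓ e) (R : ReflexiveObject C) →
    let open RibbonCategory C
        open ReflexiveObject R
    in ((lam C R ⊗₁ id {A}) ⨾ α ⨾ (id {A} ⊗₁ σ⁻ {A} {A}) ⨾ α⁻ ⨾ (app C R ⊗₁ id {A})
          ≈ id {A} ⊗₁ θ⁻ {A})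
       × (Tr C {A} {A} {A} (app C R ⨾ lam C R) ≈ id {A})
lemma4p1 C R = β-law , η-law
  where open RibbonProperties.Reflexive C R
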